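{- Directed $A$--$B$--$A$-paths do not have the (vertex-)Erdős–Pósa property: there is no function $f:\mathbb{N}\to\mathbb{N}$ such that for every positive integer $k$, every finite directed graph $D$ and all $A,B\subseteq V(D)$, the digraph $D$ contains either $k$ pairwise vertex-disjoint directed $A$--$B$--$A$-paths, or a vertex set $X\subseteq V(D)$ with $|X|\le f(k)$ meeting every directed $A$--$B$--$A$-path.
   Context: A directed $A$-path in a digraph is a directed path with at least one arc whose first and last vertices lie in $A$ and none of whose interior vertices lie in $A$. A directed $A$--$B$--$A$-path is a directed $A$-path containing at least one vertex of $B$. -}

module Defs where

open import Data.Nat using (ℕ; _≤_)
open import Data.Fin using (Fin)
open import Data.Bool using (Bool; T)
open import Data.List using (List; _∷_; []; _++_)
open import Data.List.Relation.Unary.All using (All)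
open import Data.List.Relation.Unary.Any using (Any)
open import Data.List.Relation.Unary.Unique.Propositional using (Unique)
open import Data.List.Relation.Unary.Linked using (Linked)
open import Data.List.Membership.Propositional using () renaming (_∈_ to _∈ₗ_)
open import Data.Fin.Subset using (Subset; _∈_; _∉_; ∣_∣)
open import Data.Product using (Σ; _×_; ∃)
open import Data.Sum using (_⊎_)
open import Relation.Binary.PropositionalEquality using (_≡_; _≢_)
open import Relation.Nullary using (¬_)

Digraph : ℕ → Set
Digraph n = Fin n → Fin n → Bool

-- A directed A-path is given by its vertex sequence
--   first ∷ interior ++ last ∷ []
-- (so it has at least one arc), all vertices distinct, consecutive
-- vertices joined by arcs, first and last in A, interior vertices not in A.
record IsABAPath {n : ℕ} (D : Digraph n) (A B : Subset n) (P : List (Fin n)) : Set where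
  field
    first    : Fin n
    interior : List (Fin n)
    last     : Fin n
    shape    : P ≡ first ∷ interior ++ last ∷ []
    distinct : Unique P
    arcs     : Linked (λ u v → T (D u v)) P
    firstInA : first ∈ A
    lastInA  : last ∈ A
    interiorNotInA : All (λ v → v ∉ A) interior
    meetsB   : Any (λ v → v ∈ B) P

HasDisjointABAPaths : {n : ℕ} → Digraph n → Subset n → Subset n → ℕ → Set
HasDisjointABAPaths {n} D A B k =
  Σ (Fin k → List (Fin n)) λ P →
    ((i : Fin k) → IsABAPath D A B (P i)) ×
    ((i j : Fin k) → i ≢ j → (v : Fin n) → v ∈ₗ P i → ¬ (v ∈ₗ P j))

HitsAllABAPaths : {n : ℕ} → Digraph n → Subset n → Subset n → Subset n → Set
HitsAllABAPaths {n} D A B X =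
  (P : List (Fin n)) → IsABAPath D A B P → ∃ λ v → v ∈ₗ P × v ∈ X

ErdosPosaABA : (ℕ → ℕ) → Set
ErdosPosaABA f =
  (k : ℕ) → 1 ≤ k → (n : ℕ) (D : Digraph n) (A B : Subset n) →
    HasDisjointABAPaths D A B k ⊎
    (Σ (Subset n) λ X → ∣ X ∣ ≤ f k × HitsAllABAPaths D A B X)

module Submission where

-- The counterexample is the (M+1)×(M+1) grid in which every vertex has an arc to its right
-- neighbour and the vertices of the inner columns 1, …, M−1 also have arcs to both vertical
-- neighbours; A is the union of the outer columns and B is the top row.  An A-path runs from
-- column 0 to column M.  Of two disjoint ones, the one starting lower stays strictly below the
-- other in every column, because the upper one must leave each column above it; so the lower one
-- never meets the top row.  On the other hand, at most K vertices miss one of the rows 0, …, K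
-- and one of the column pairs {2i+1, 2i+2} (i ≤ K), and if M ≥ 2K+3 the path along the free row
-- that detours up the first column of the free pair and down the second is an A–B–A-path
-- avoiding them.  Taking k = 2 and K = f 2 refutes any bound f.

open import Defs
open import Data.Bool using (T)
open import Data.Empty using (⊥; ⊥-elim)
open import Data.Fin as Fin using (Fin; toℕ; combine; remQuot)
open import Data.Fin.Properties
  using (toℕ-injective; toℕ<n; toℕ-fromℕ<; combine-remQuot; remQuot-combine; all?; any?; ¬∀⟶∃¬)
  renaming (suc-injective to Fin-suc-injective; 0≢1+n to Fin-0≢1+n)
open import Data.Fin.Subset using (Subset; _∈_; _∉_; ∣_∣; _-_)
open import Data.Fin.Subset.Properties using (_∈?_; x∈p⇒∣p-x∣<∣p∣; x∈p∧x≢y⇒x∈p-y)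
open import Data.List using (List; []; _∷_; _++_; map; replicate)
open import Data.List.Membership.Propositional using (find; lose) renaming (_∈_ to _∈ₗ_; _∉_ to _∉ₗ_)
open import Data.List.Membership.Propositional.Properties using (∈-map⁺; ∈-map⁻)
open import Data.List.Properties using (map-++)
open import Data.List.Relation.Binary.Disjoint.Propositional using (Disjoint)
import Data.List.Relation.Binary.Disjoint.Propositional.Properties as Disjoint
open import Data.List.Relation.Unary.All as All using (All; []; _∷_)
import Data.List.Relation.Unary.All.Properties as All
import Data.List.Relation.Unary.AllPairs as AllPairs
open import Data.List.Relation.Unary.Any as Any using (Any; here; there)
import Data.List.Relation.Unary.Any.Properties as Any
open import Data.List.Relation.Unary.Linked using (Linked; []; [-]; _∷_)
import Data.List.Relation.Unary.Linked as Linked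
import Data.List.Relation.Unary.Linked.Properties as Linked
open import Data.List.Relation.Unary.Unique.Propositional using (Unique)
open import Data.Nat using (ℕ; zero; suc; _+_; _*_; _∸_; _≤_; _<_; z≤n; s≤s; z<s; s<s; _≟_; _<?_; _≤?_; pred; ⌊_/2⌋)
open import Data.Nat.DivMod using (_mod_; m<n⇒m%n≡m)
open import Data.Nat.Properties
open import Data.Product using (Σ; _×_; ∃; ∃₂; _,_; proj₁; proj₂; uncurry)
open import Data.Product.Properties using (×-≡,≡→≡)
open import Data.Product.Relation.Binary.Lex.Strict using (×-Lex; ×-transitive; ×-irreflexive)
open import Data.Sum using (_⊎_; inj₁; inj₂; [_,_]′)
open import Data.Unit using (⊤; tt)
open import Data.Vec using (tabulate)
open import Data.Vec.Properties using (lookup∘tabulate; []=⇒lookup; lookup⇒[]=)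
open import Function using (id; _∘_; _on_)
open import Function.Definitions using (Injective)
open import Relation.Binary using (tri<; tri≈; tri>)
open import Relation.Binary.PropositionalEquality
open import Relation.Nullary using (¬_; Dec; yes; no; does)
open import Relation.Nullary.Decidable using (⌊_⌋; dec-true; toWitness; fromWitness; _×-dec_; _⊎-dec_)
open import Relation.Unary using (Decidable)

select : ∀ {n} {P : Fin n → Set} → Decidable P → Subset n
select P? = tabulate (does ∘ P?)

∈-select⁻ : ∀ {n} {P : Fin n → Set} (P? : Decidable P) {v} → v ∈ select P? → P v
∈-select⁻ P? {v} v∈ with P? v | trans (sym (lookup∘tabulate (does ∘ P?) v)) ([]=⇒lookup v∈)
... | yes p | _ = p
... | no _ | ()

∈-select⁺ : ∀ {n} {P : Fin n → Set} (P? : Decidable P) {v} → P v → v ∈ select P?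
∈-select⁺ P? {v} p = lookup⇒[]= v _ (trans (lookup∘tabulate (does ∘ P?) v) (dec-true (P? v) p))

injection⇒≤∣p∣ : ∀ {m n} (p : Subset n) (r : Fin m → Fin n) → Injective _≡_ _≡_ r → (∀ i → r i ∈ p) →
                 m ≤ ∣ p ∣
injection⇒≤∣p∣ {zero}  p r r-inj r∈p = z≤n
injection⇒≤∣p∣ {suc m} p r r-inj r∈p = ≤-trans (s≤s rest≤) (x∈p⇒∣p-x∣<∣p∣ (r∈p Fin.zero))
  where
    rest≤ : m ≤ ∣ p - r Fin.zero ∣
    rest≤ = injection⇒≤∣p∣ (p - r Fin.zero) (r ∘ Fin.suc) (Fin-suc-injective ∘ r-inj)
              (λ i → x∈p∧x≢y⇒x∈p-y (r∈p (Fin.suc i)) (λ e → Fin-0≢1+n (sym (r-inj e))))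

∣p∣≤k⇒misses-fibre : ∀ {n} k (p : Subset n) (ℓ : Fin n → ℕ) → ∣ p ∣ ≤ k →
                     ∃ λ (i : Fin (suc k)) → ∀ {v} → v ∈ p → ℓ v ≢ toℕ i
∣p∣≤k⇒misses-fibre k p ℓ ∣p∣≤k = decide (all? hit?)
  where
    Hit : Fin (suc k) → Set
    Hit i = ∃ λ v → v ∈ p × ℓ v ≡ toℕ i

    hit? : Decidable Hit
    hit? i = any? λ v → (v ∈? p) ×-dec (ℓ v ≟ toℕ i)

    decide : Dec (∀ i → Hit i) → ∃ λ (i : Fin (suc k)) → ∀ {v} → v ∈ p → ℓ v ≢ toℕ i
    decide (yes hit) = ⊥-elim (<⇒≱ (s≤s ∣p∣≤k) (injection⇒≤∣p∣ p (proj₁ ∘ hit) r-inj (proj₁ ∘ proj₂ ∘ hit)))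
      where
        ℓ-hit : ∀ i → ℓ (proj₁ (hit i)) ≡ toℕ i
        ℓ-hit i = proj₂ (proj₂ (hit i))

        r-inj : Injective _≡_ _≡_ (proj₁ ∘ hit)
        r-inj {i} {j} e = toℕ-injective (trans (sym (ℓ-hit i)) (trans (cong ℓ e) (ℓ-hit j)))
    decide (no ¬hit) = let i , unhit = ¬∀⟶∃¬ _ _ hit? ¬hit in i , λ v∈p ℓv≡i → unhit (_ , v∈p , ℓv≡i)

module _ {A : Set} {R : A → A → Set} where

  Linked-head-successor : ∀ {x y} xs → Linked R (x ∷ xs ++ y ∷ []) → ∃ (R x)
  Linked-head-successor []      (r ∷ _) = _ , r
  Linked-head-successor (_ ∷ _) (r ∷ _) = _ , r

  Linked-last-predecessor : ∀ {x y} xs → Linked R (x ∷ xs ++ y ∷ []) → ∃ λ u → R u y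
  Linked-last-predecessor []       (r ∷ _) = _ , r
  Linked-last-predecessor (_ ∷ xs) (_ ∷ l) = Linked-last-predecessor xs l

  Linked-interior-neighbours : ∀ {x y} xs → Linked R (x ∷ xs ++ y ∷ []) →
                               All (λ v → ∃ (λ u → R u v) × ∃ (R v)) xs
  Linked-interior-neighbours []       _       = []
  Linked-interior-neighbours (_ ∷ xs) (r ∷ l) =
    ((_ , r) , Linked-head-successor xs l) ∷ Linked-interior-neighbours xs l

Linked⇒Unique : ∀ {A B : Set} {_<_ : B → B → Set} (key : A → B) → (∀ {a b c} → a < b → b < c → a < c) →
                (∀ {b} → ¬ b < b) → ∀ {xs} → Linked (_<_ on key) xs → Unique xs
Linked⇒Unique {_<_ = _<_} key <-trans′ <-irrefl′ l =
  AllPairs.map (λ key< x≡y → <-irrefl′ (subst (λ z → key _ < key z) (sym x≡y) key<))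
    (Linked.Linked⇒AllPairs (λ {x y z} → <-trans′ {key x} {key y} {key z}) l)

_<ₗₑₓ_ : ℕ × ℕ → ℕ × ℕ → Set
_<ₗₑₓ_ = ×-Lex _≡_ _<_ _<_

<ₗₑₓ-trans : ∀ {a b c} → a <ₗₑₓ b → b <ₗₑₓ c → a <ₗₑₓ c
<ₗₑₓ-trans {a} {b} {c} = ×-transitive {_≈₁_ = _≡_} {_<₁_ = _<_} {_<₂_ = _<_}
  isEquivalence (resp₂ _<_) (λ {i j k} → <-trans {i} {j} {k}) (λ {i j k} → <-trans {i} {j} {k}) {a} {b} {c}

<ₗₑₓ-irrefl : ∀ {a} → ¬ a <ₗₑₓ a
<ₗₑₓ-irrefl {a} =
  ×-irreflexive {_≈₁_ = _≡_} {_<₁_ = _<_} {_≈₂_ = _≡_} {_<₂_ = _<_} <-irrefl <-irrefl {a} {a} (refl , refl)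

Pos : Set
Pos = ℕ × ℕ

data Move : Set where
  east north south : Move

step : Move → Pos → Pos
step east  (x , y) = suc x , y
step north (x , y) = x , suc y
step south (x , y) = x , y ∸ 1

walk : Pos → List Move → List Pos
walk p []       = p ∷ []
walk p (m ∷ ms) = p ∷ walk (step m p) ms

beforeEnd : Pos → List Move → List Pos
beforeEnd p []       = []
beforeEnd p (m ∷ ms) = p ∷ beforeEnd (step m p) ms

end : Pos → List Move → Pos
end p []       = p
end p (m ∷ ms) = end (step m p) ms

walk≡beforeEnd++end : ∀ p ms → walk p ms ≡ beforeEnd p ms ++ end p ms ∷ []
walk≡beforeEnd++end p []       = refl
walk≡beforeEnd++end p (m ∷ ms) = cong (p ∷_) (walk≡beforeEnd++end (step m p) ms)

end-++ : ∀ p ms ms′ → end p (ms ++ ms′) ≡ end (end p ms) ms′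
end-++ p []       ms′ = refl
end-++ p (m ∷ ms) ms′ = end-++ (step m p) ms ms′

end∈walk-++ : ∀ p ms ms′ → end p ms ∈ₗ walk p (ms ++ ms′)
end∈walk-++ p []       []        = here refl
end∈walk-++ p []       (_ ∷ _)   = here refl
end∈walk-++ p (m ∷ ms) ms′       = there (end∈walk-++ (step m p) ms ms′)

end-east : ∀ k x y → end (x , y) (replicate k east) ≡ (x + k , y)
end-east zero    x y = cong (_, y) (sym (+-identityʳ x))
end-east (suc k) x y = trans (end-east k (suc x) y) (cong (_, y) (sym (+-suc x k)))

end-north : ∀ k x y → end (x , y) (replicate k north) ≡ (x , y + k)
end-north zero    x y = cong (x ,_) (sym (+-identityʳ y))
end-north (suc k) x y = trans (end-north k x (suc y)) (cong (x ,_) (sym (+-suc y k)))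

end-south : ∀ k x y → end (x , y) (replicate k south) ≡ (x , y ∸ k)
end-south zero    x y = refl
end-south (suc k) x y = trans (end-south k x (y ∸ 1)) (cong (x ,_) (∸-+-assoc y 1 k))

module _ (R : Pos → Pos → Set) where

  Allowed : Pos → List Move → Set
  Allowed p []       = ⊤
  Allowed p (m ∷ ms) = R p (step m p) × Allowed (step m p) ms

  Allowed⇒Linked : ∀ p ms → Allowed p ms → Linked R (walk p ms)
  Allowed⇒Linked p []           _        = [-]
  Allowed⇒Linked p (m ∷ [])     (r , _)  = r ∷ [-]
  Allowed⇒Linked p (m ∷ m′ ∷ ms) (r , a) = r ∷ Allowed⇒Linked (step m p) (m′ ∷ ms) a

  Allowed-++ : ∀ p ms ms′ → Allowed p ms → Allowed (end p ms) ms′ → Allowed p (ms ++ ms′)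
  Allowed-++ p []       ms′ _       a′ = a′
  Allowed-++ p (m ∷ ms) ms′ (r , a) a′ = r , Allowed-++ (step m p) ms ms′ a a′

  Allowed-replicate : ∀ {m} p k → (∀ j → j < k → let q = end p (replicate j m) in R q (step m q)) →
                      Allowed p (replicate k m)
  Allowed-replicate p zero    _ = tt
  Allowed-replicate p (suc k) r = r 0 z<s , Allowed-replicate _ k (λ j j<k → r (suc j) (s<s j<k))

  Allowed⇒All : ∀ {G : Pos → Set} → (∀ {p q} → R p q → G q) →
                ∀ p ms → G p → Allowed p ms → All G (walk p ms)
  Allowed⇒All R⇒G p []       g _       = g ∷ []
  Allowed⇒All R⇒G p (m ∷ ms) g (r , a) = g ∷ Allowed⇒All R⇒G (step m p) ms (R⇒G r) a

module Grid (M : ℕ) where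

  Bounded : Pos → Set
  Bounded (x , y) = x ≤ M × y ≤ M

  N : ℕ
  N = suc M * suc M

  coords : Fin N → Fin (suc M) × Fin (suc M)
  coords = remQuot (suc M)

  pos : Fin N → Pos
  pos v = toℕ (proj₁ (coords v)) , toℕ (proj₂ (coords v))

  -- Coordinates are reduced modulo M + 1, so vertex inverts pos only on Bounded positions.
  vertex : Pos → Fin N
  vertex (x , y) = combine (x mod suc M) (y mod suc M)

  pos-bounded : ∀ v → Bounded (pos v)
  pos-bounded v = ≤-pred (toℕ<n _) , ≤-pred (toℕ<n _)

  pos-injective : Injective _≡_ _≡_ pos
  pos-injective {u} {v} eq = begin
    u                          ≡⟨ combine-remQuot (suc M) u ⟨
    uncurry combine (coords u) ≡⟨ cong (uncurry combine) coords-equal ⟩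
    uncurry combine (coords v) ≡⟨ combine-remQuot (suc M) v ⟩
    v                          ∎
    where
      open ≡-Reasoning
      coords-equal : coords u ≡ coords v
      coords-equal = ×-≡,≡→≡ (toℕ-injective (cong proj₁ eq) , toℕ-injective (cong proj₂ eq))

  pos-vertex : ∀ {p} → Bounded p → pos (vertex p) ≡ p
  pos-vertex {x , y} (x≤M , y≤M) =
    trans (cong (λ (i , j) → toℕ i , toℕ j) (remQuot-combine (x mod suc M) (y mod suc M)))
          (×-≡,≡→≡ (toℕ-mod x≤M , toℕ-mod y≤M))
    where
      toℕ-mod : ∀ {z} → z ≤ M → toℕ (z mod suc M) ≡ z
      toℕ-mod z≤M = trans (toℕ-fromℕ< _) (m<n⇒m%n≡m (s≤s z≤M))

  data GridArc : Pos → Pos → Set where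
    right : ∀ {x y} → GridArc (x , y) (suc x , y)
    up    : ∀ {x y} → 1 ≤ x → x < M → GridArc (x , y) (x , suc y)
    down  : ∀ {x y} → 1 ≤ x → x < M → GridArc (x , suc y) (x , y)

  gridArc? : ∀ p q → Dec (GridArc p q)
  gridArc? (x , y) (x′ , y′) with x′ ≟ suc x | x′ ≟ x
  ... | yes refl | _ with y′ ≟ y
  ...   | yes refl = yes right
  ...   | no y′≢y  = no λ { right → y′≢y refl }
  gridArc? (x , y) (x′ , y′) | no x′≢1+x | no x′≢x =
    no λ { right → x′≢1+x refl ; (up _ _) → x′≢x refl ; (down _ _) → x′≢x refl }
  gridArc? (x , y) (x′ , y′) | no _ | yes refl with 1 ≤? x | x <? M
  ... | no 1≰x | _ = no λ { (up 1≤x _) → 1≰x 1≤x ; (down 1≤x _) → 1≰x 1≤x }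
  ... | yes _ | no x≮M = no λ { (up _ x<M) → x≮M x<M ; (down _ x<M) → x≮M x<M }
  ... | yes 1≤x | yes x<M with y′ ≟ suc y | y ≟ suc y′
  ...   | yes refl | _        = yes (up 1≤x x<M)
  ...   | no _     | yes refl = yes (down 1≤x x<M)
  ...   | no y′≢1+y | no y≢1+y′ = no λ { (up _ _) → y′≢1+y refl ; (down _ _) → y≢1+y′ refl }

  grid : Digraph N
  grid u v = ⌊ gridArc? (pos u) (pos v) ⌋

  arc⇒gridArc : ∀ {u v} → T (grid u v) → GridArc (pos u) (pos v)
  arc⇒gridArc {u} {v} = toWitness {a? = gridArc? (pos u) (pos v)}

  gridArc⇒arc : ∀ {u v} → GridArc (pos u) (pos v) → T (grid u v)
  gridArc⇒arc {u} {v} = fromWitness {a? = gridArc? (pos u) (pos v)}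

  OnSide : Pos → Set
  OnSide (x , _) = x ≡ 0 ⊎ x ≡ M

  onSide? : ∀ p → Dec (OnSide p)
  onSide? (x , _) = (x ≟ 0) ⊎-dec (x ≟ M)

  OnTop : Pos → Set
  OnTop (_ , y) = y ≡ M

  onTop? : ∀ p → Dec (OnTop p)
  onTop? (_ , y) = y ≟ M

  sides : Subset N
  sides = select (onSide? ∘ pos)

  top : Subset N
  top = select (onTop? ∘ pos)

  vertex∈sides : ∀ {p} → Bounded p → OnSide p → vertex p ∈ sides
  vertex∈sides p-bounded = ∈-select⁺ (onSide? ∘ pos) ∘ subst OnSide (sym (pos-vertex p-bounded))

  vertex∈top : ∀ {p} → Bounded p → OnTop p → vertex p ∈ top
  vertex∈top p-bounded = ∈-select⁺ (onTop? ∘ pos) ∘ subst OnTop (sym (pos-vertex p-bounded))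

  gridArc-source-x<M : ∀ {p q} → GridArc p q → proj₁ q ≤ M → proj₁ p < M
  gridArc-source-x<M right        x′≤M = x′≤M
  gridArc-source-x<M (up _ x<M)   _    = x<M
  gridArc-source-x<M (down _ x<M) _    = x<M

  gridArc-target-1≤x : ∀ {p q} → GridArc p q → 1 ≤ proj₁ q
  gridArc-target-1≤x right        = s≤s z≤n
  gridArc-target-1≤x (up 1≤x _)   = 1≤x
  gridArc-target-1≤x (down 1≤x _) = 1≤x

  arc-source-x<M : ∀ {u v} → T (grid u v) → proj₁ (pos u) < M
  arc-source-x<M {u} {v} a = gridArc-source-x<M (arc⇒gridArc {u} {v} a) (proj₁ (pos-bounded v))

  arc-target-1≤x : ∀ {u v} → T (grid u v) → 1 ≤ proj₁ (pos v)
  arc-target-1≤x {u} {v} a = gridArc-target-1≤x (arc⇒gridArc {u} {v} a)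

  source∈sides⇒left : ∀ {u v} → u ∈ sides → T (grid u v) → proj₁ (pos u) ≡ 0
  source∈sides⇒left {u} {v} u∈sides arc =
    [ id , (λ x≡M → ⊥-elim (<-irrefl x≡M (arc-source-x<M {u} {v} arc))) ]′
      (∈-select⁻ (onSide? ∘ pos) u∈sides)

  target∈sides⇒right : ∀ {u v} → v ∈ sides → T (grid u v) → proj₁ (pos v) ≡ M
  target∈sides⇒right {u} {v} v∈sides arc =
    [ (λ x≡0 → ⊥-elim (<-irrefl (sym x≡0) (arc-target-1≤x {u} {v} arc))) , id ]′
      (∈-select⁻ (onSide? ∘ pos) v∈sides)

  interior-vertex∉sides : ∀ {u v w} → T (grid u v) → T (grid v w) → v ∉ sides
  interior-vertex∉sides {u} {v} {w} in-arc out-arc v∈sides =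
    <-irrefl (sym (source∈sides⇒left {v} {w} v∈sides out-arc)) (arc-target-1≤x {u} {v} in-arc)

  EndsRight : Pos → List Pos → Set
  EndsRight p []       = proj₁ p ≡ M
  EndsRight _ (q ∷ ps) = EndsRight q ps

  record Crossing (s : Pos) (ps : List Pos) : Set where
    field
      startsLeft : proj₁ s ≡ 0
      endsRight  : EndsRight s ps
      linked     : Linked GridArc (s ∷ ps)
      bounded    : All Bounded (s ∷ ps)
      reachesTop : Any OnTop (s ∷ ps)

  Above : ℕ → ℕ → Pos → Set
  Above x h q = proj₁ q ≡ x × h < proj₂ q

  -- Inside column x the walk moves one unit at a time and avoids (x , h), so it stays above h
  -- until it leaves the column, which it must do to the right since it ends in column M.
  exitsColumnAbove : ∀ {x y h} ps → Linked GridArc ((x , y) ∷ ps) → EndsRight (x , y) ps → x < M → h < y →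
                     (x , h) ∉ₗ ps → Any (Above (suc x) h) ps
  exitsColumnAbove []       [-]             x≡M x<M _   _  = ⊥-elim (<-irrefl x≡M x<M)
  exitsColumnAbove (_ ∷ _)  (right ∷ _)     _   _   h<y _  = here (refl , h<y)
  exitsColumnAbove (_ ∷ ps) (up _ _ ∷ l)    e   x<M h<y h∉ =
    there (exitsColumnAbove ps l e x<M (m<n⇒m<1+n h<y) (h∉ ∘ there))
  exitsColumnAbove (_ ∷ ps) (down _ _ ∷ l)  e   x<M h<y h∉ =
    there (exitsColumnAbove ps l e x<M (≤∧≢⇒< (≤-pred h<y) (h∉ ∘ here ∘ cong (_ ,_))) (h∉ ∘ there))

  Any-exitsColumnAbove : ∀ s ps → Linked GridArc (s ∷ ps) → EndsRight s ps →
                         ∀ {x h} → x < M → (x , h) ∉ₗ (s ∷ ps) →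
                         Any (Above x h) (s ∷ ps) → Any (Above (suc x) h) (s ∷ ps)
  Any-exitsColumnAbove (x , y) ps       l       e x<M h∉ (here (refl , h<y)) =
    there (exitsColumnAbove ps l e x<M h<y (h∉ ∘ there))
  Any-exitsColumnAbove s       (q ∷ ps) (_ ∷ l) e x<M h∉ (there a)          =
    there (Any-exitsColumnAbove q ps l e x<M (h∉ ∘ there) a)

  Any-Above-suc : ∀ {x y qs} → (x , suc y) ∉ₗ qs → Any (Above x y) qs → Any (Above x (suc y)) qs
  Any-Above-suc y′∉ (here (refl , y<h)) = here (refl , ≤∧≢⇒< y<h (y′∉ ∘ here ∘ cong (_ ,_)))
  Any-Above-suc y′∉ (there a)           = there (Any-Above-suc (y′∉ ∘ there) a)

  module _ {t qs} (Q : Crossing t qs) where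
    open Crossing Q

    Below : Pos → Set
    Below p = Any (Above (proj₁ p) (proj₂ p)) (t ∷ qs)

    Below-step : ∀ {p q} → GridArc p q → Bounded q → p ∉ₗ (t ∷ qs) → q ∉ₗ (t ∷ qs) → Below p → Below q
    Below-step right      (x′≤M , _) p∉ _  = Any-exitsColumnAbove t qs linked endsRight x′≤M p∉
    Below-step (up _ _)   _          _  q∉ = Any-Above-suc q∉
    Below-step (down _ _) _          _  _  = Any.map λ (x≡ , y<h) → x≡ , <⇒≤ y<h

    staysBelow : ∀ {s ps} → Linked GridArc (s ∷ ps) → All Bounded (s ∷ ps) → Disjoint (s ∷ ps) (t ∷ qs) →
                 Below s → All Below (s ∷ ps)
    staysBelow [-]     _        _    b = b ∷ []
    staysBelow (a ∷ l) (_ ∷ bs) disj b =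
      b ∷ staysBelow l bs (λ (p∈ , p∈Q) → disj (there p∈ , p∈Q))
            (Below-step a (All.head bs) (λ s∈Q → disj (here refl , s∈Q)) (λ q∈Q → disj (there (here refl) , q∈Q))
              b)

    lowerCrossing-⊥ : ∀ {s ps} → Crossing s ps → Disjoint (s ∷ ps) (t ∷ qs) → proj₂ s < proj₂ t → ⊥
    lowerCrossing-⊥ P disj s<t =
      let p , p∈P , p≡M    = find (Crossing.reachesTop P)
          q , q∈Q , _ , p<q = find (All.lookup belowAll p∈P)
      in <⇒≱ (subst (_< proj₂ q) p≡M p<q) (proj₂ (All.lookup bounded q∈Q))
      where
        belowAll : All Below (_ ∷ _)
        belowAll = staysBelow (Crossing.linked P) (Crossing.bounded P) disj
                     (here (trans startsLeft (sym (Crossing.startsLeft P)) , s<t))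

  noDisjointCrossings : ∀ {s ps t qs} → Crossing s ps → Crossing t qs → Disjoint (s ∷ ps) (t ∷ qs) → ⊥
  noDisjointCrossings {s} {t = t} P Q disj with <-cmp (proj₂ s) (proj₂ t)
  ... | tri< s<t _ _ = lowerCrossing-⊥ Q P disj s<t
  ... | tri> _ _ t<s = lowerCrossing-⊥ P Q (Disjoint.sym disj) t<s
  ... | tri≈ _ s≡t _ =
    disj (here refl , here (×-≡,≡→≡ (trans (Crossing.startsLeft P) (sym (Crossing.startsLeft Q)) , s≡t)))

  EndsRight-map : ∀ {w} p xs → proj₁ (pos w) ≡ M → EndsRight p (map pos (xs ++ w ∷ []))
  EndsRight-map p []       w-right = w-right
  EndsRight-map p (x ∷ xs) w-right = EndsRight-map (pos x) xs w-right

  map-pos-bounded : ∀ vs → All Bounded (map pos vs)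
  map-pos-bounded vs = All.map⁺ (All.universal pos-bounded vs)

  ABAPath⇒Crossing : ∀ {P} → IsABAPath grid sides top P → ∃₂ λ s ps → map pos P ≡ s ∷ ps × Crossing s ps
  ABAPath⇒Crossing {P} path = _ , _ , cong (map pos) shape , record
    { startsLeft = source∈sides⇒left {first} {proj₁ first-out} firstInA (proj₂ first-out)
    ; endsRight  = EndsRight-map (pos first) interior (target∈sides⇒right {proj₁ last-in} lastInA (proj₂ last-in))
    ; linked     = Linked.map⁺ (Linked.map (λ {u v} → arc⇒gridArc {u} {v}) arcs′)
    ; bounded    = map-pos-bounded (first ∷ interior ++ last ∷ [])
    ; reachesTop = Any.map⁺ (Any.map (∈-select⁻ (onTop? ∘ pos)) (subst (Any _) shape meetsB))
    }
    where
      open IsABAPath path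
      arcs′ : Linked (λ u v → T (grid u v)) (first ∷ interior ++ last ∷ [])
      arcs′ = subst (Linked _) shape arcs
      first-out = Linked-head-successor interior arcs′
      last-in   = Linked-last-predecessor interior arcs′

  map-pos-disjoint : ∀ {P Q} → (∀ v → v ∈ₗ P → ¬ v ∈ₗ Q) → Disjoint (map pos P) (map pos Q)
  map-pos-disjoint {Q = Q} disj (p∈P , p∈Q) with ∈-map⁻ pos p∈P | ∈-map⁻ pos p∈Q
  ... | v , v∈P , refl | w , w∈Q , pv≡pw = disj v v∈P (subst (_∈ₗ Q) (sym (pos-injective pv≡pw)) w∈Q)

  noTwoDisjointABAPaths : ¬ HasDisjointABAPaths grid sides top 2
  noTwoDisjointABAPaths (P , paths , disj)
    with ABAPath⇒Crossing (paths Fin.zero) | ABAPath⇒Crossing (paths (Fin.suc Fin.zero))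
  ... | _ , _ , P≡ , P′ | _ , _ , Q≡ , Q′ =
    noDisjointCrossings P′ Q′ (subst₂ Disjoint P≡ Q≡ (map-pos-disjoint (disj Fin.zero (Fin.suc Fin.zero) λ ())))

  Linked-vertices : ∀ {R : Pos → Pos → Set} {ps} → All Bounded ps → Linked R ps → Linked (R on pos) (map vertex ps)
  Linked-vertices     _                  []      = []
  Linked-vertices     _                  [-]     = [-]
  Linked-vertices {R} (bp ∷ bs@(bq ∷ _)) (r ∷ l) =
    subst₂ R (sym (pos-vertex bp)) (sym (pos-vertex bq)) r ∷ Linked-vertices bs l

  module Detour (S : Subset N) {y b : ℕ} (y≤M : y ≤ M) (b+2<M : suc (suc b) < M)
                (row-free : ∀ {v} → v ∈ S → proj₂ (pos v) ≢ y)
                (columns-free : ∀ {v} → v ∈ S → proj₁ (pos v) ≢ suc b × proj₁ (pos v) ≢ suc (suc b)) where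

    -- c = b + 1 because column 0 carries no vertical arcs.
    c : ℕ
    c = suc b

    c<M : c < M
    c<M = <-trans (n<1+n c) b+2<M

    Good : Pos → Set
    Good p = Bounded p × vertex p ∉ S

    good : ∀ {p} → Bounded p → (∀ {v} → v ∈ S → pos v ≢ p) → Good p
    good p-bounded p-free = p-bounded , λ v∈S → p-free v∈S (pos-vertex p-bounded)

    good-row : ∀ {x} → x ≤ M → Good (x , y)
    good-row x≤M = good (x≤M , y≤M) λ v∈S → row-free v∈S ∘ cong proj₂

    good-column : ∀ {h} → h ≤ M → Good (c , h)
    good-column h≤M = good (<⇒≤ c<M , h≤M) λ v∈S → proj₁ (columns-free v∈S) ∘ cong proj₁

    good-next-column : ∀ {h} → h ≤ M → Good (suc c , h)
    good-next-column h≤M = good (<⇒≤ b+2<M , h≤M) λ v∈S → proj₂ (columns-free v∈S) ∘ cong proj₁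

    -- The rank increases lexicographically along the detour, which makes its vertices distinct;
    -- the detour runs down column c + 1, so heights there are ranked in reverse.
    height : ℕ → ℕ → ℕ
    height x h with x ≟ suc c
    ... | yes _ = M ∸ h
    ... | no  _ = h

    height-column : ∀ h → height c h ≡ h
    height-column h with c ≟ suc c
    ... | yes c≡c+1 = ⊥-elim (1+n≢n (sym c≡c+1))
    ... | no  _     = refl

    height-next-column : ∀ h → height (suc c) h ≡ M ∸ h
    height-next-column h with suc c ≟ suc c
    ... | yes _     = refl
    ... | no  c≢c   = ⊥-elim (c≢c refl)

    rank : Pos → ℕ × ℕ
    rank (x , h) = x , height x h

    Step : Pos → Pos → Set
    Step p q = GridArc p q × rank p <ₗₑₓ rank q × Good q

    step-east : ∀ {x h} → Good (suc x , h) → Step (x , h) (suc x , h)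
    step-east g = right , inj₁ ≤-refl , g

    step-north : ∀ {h} → suc h ≤ M → Step (c , h) (c , suc h)
    step-north {h} h<M =
      up (s≤s z≤n) c<M ,
      inj₂ (refl , subst₂ _<_ (sym (height-column h)) (sym (height-column (suc h))) (n<1+n h)) ,
      good-column h<M

    step-south : ∀ {h} → 0 < h → h ≤ M → Step (suc c , h) (suc c , h ∸ 1)
    step-south {suc h} _ h<M =
      down (s≤s z≤n) b+2<M ,
      inj₂ (refl , subst₂ _<_ (sym (height-next-column (suc h))) (sym (height-next-column h))
                     (∸-monoʳ-< (n<1+n h) h<M)) ,
      good-next-column (<⇒≤ h<M)

    east-leg : ∀ x k → x + k ≤ M → Allowed Step (x , y) (replicate k east)
    east-leg x k x+k≤M = Allowed-replicate Step (x , y) k λ j j<k →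
      subst (λ q → Step q (step east q)) (sym (end-east j x y))
        (step-east (good-row (≤-trans (+-monoʳ-< x j<k) x+k≤M)))

    north-leg : ∀ k → y + k ≤ M → Allowed Step (c , y) (replicate k north)
    north-leg k y+k≤M = Allowed-replicate Step (c , y) k λ j j<k →
      subst (λ q → Step q (step north q)) (sym (end-north j c y))
        (step-north (≤-trans (+-monoʳ-< y j<k) y+k≤M))

    south-leg : ∀ k → k ≤ M → Allowed Step (suc c , M) (replicate k south)
    south-leg k k≤M = Allowed-replicate Step (suc c , M) k λ j j<k →
      subst (λ q → Step q (step south q)) (sym (end-south j (suc c) M))
        (step-south (m<n⇒0<n∸m (<-≤-trans j<k k≤M)) (m∸n≤m M j))

    start : Pos
    start = 0 , y

    ascent descent route : List Move
    ascent  = replicate c east ++ replicate (M ∸ y) north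
    descent = east ∷ replicate (M ∸ y) south ++ replicate (M ∸ suc c) east
    route   = ascent ++ descent

    summit : end start ascent ≡ (c , M)
    summit = begin
      end start ascent                                             ≡⟨ end-++ start (replicate c east) _ ⟩
      end (end start (replicate c east)) (replicate (M ∸ y) north) ≡⟨ cong (λ p → end p (replicate (M ∸ y) north))
                                                                           (end-east c 0 y) ⟩
      end (c , y) (replicate (M ∸ y) north)                        ≡⟨ end-north (M ∸ y) c y ⟩
      (c , y + (M ∸ y))                                            ≡⟨ cong (c ,_) (m+[n∸m]≡n y≤M) ⟩
      (c , M)                                                      ∎
      where open ≡-Reasoning

    foot : end (suc c , M) (replicate (M ∸ y) south) ≡ (suc c , y)
    foot = trans (end-south (M ∸ y) (suc c) M) (cong (suc c ,_) (m∸[m∸n]≡n y≤M))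

    route-end : end start route ≡ (M , y)
    route-end = begin
      end start route                                        ≡⟨ end-++ start ascent descent ⟩
      end (end start ascent) descent                         ≡⟨ cong (λ p → end p descent) summit ⟩
      end (suc c , M) (replicate (M ∸ y) south ++ replicate (M ∸ suc c) east)
                                                             ≡⟨ end-++ (suc c , M) (replicate (M ∸ y) south) _ ⟩
      end (end (suc c , M) (replicate (M ∸ y) south)) (replicate (M ∸ suc c) east)
                                                             ≡⟨ cong (λ p → end p (replicate (M ∸ suc c) east)) foot ⟩
      end (suc c , y) (replicate (M ∸ suc c) east)           ≡⟨ end-east (M ∸ suc c) (suc c) y ⟩
      (suc c + (M ∸ suc c) , y)                              ≡⟨ cong (_, y) (m+[n∸m]≡n (<⇒≤ b+2<M)) ⟩
      (M , y)                                                ∎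
      where open ≡-Reasoning

    route-allowed : Allowed Step start route
    route-allowed = Allowed-++ Step start ascent descent ascent-allowed
                      (subst (λ p → Allowed Step p descent) (sym summit) descent-allowed)
      where
        ascent-allowed : Allowed Step start ascent
        ascent-allowed =
          Allowed-++ Step start (replicate c east) _ (east-leg 0 c (<⇒≤ c<M))
            (subst (λ p → Allowed Step p _) (sym (end-east c 0 y))
              (north-leg (M ∸ y) (≤-reflexive (m+[n∸m]≡n y≤M))))

        descent-allowed : Allowed Step (c , M) descent
        descent-allowed = step-east (good-next-column ≤-refl) ,
          Allowed-++ Step (suc c , M) (replicate (M ∸ y) south) _ (south-leg (M ∸ y) (m∸n≤m M y))
            (subst (λ p → Allowed Step p _) (sym foot)
              (east-leg (suc c) (M ∸ suc c) (≤-reflexive (m+[n∸m]≡n (<⇒≤ b+2<M)))))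

    route-good : All Good (walk start route)
    route-good = Allowed⇒All Step (proj₂ ∘ proj₂) start route (good-row z≤n) route-allowed

    detour : List (Fin N)
    detour = map vertex (walk start route)

    detour-steps : Linked (Step on pos) detour
    detour-steps = Linked-vertices (All.map proj₁ route-good) (Allowed⇒Linked Step start route route-allowed)

    detour-arcs : Linked (λ u v → T (grid u v)) detour
    detour-arcs = Linked.map (λ {u v} → gridArc⇒arc {u} {v} ∘ proj₁) detour-steps

    detour-isABAPath : IsABAPath grid sides top detour
    detour-isABAPath = record
      { first          = vertex start
      ; interior       = map vertex (beforeEnd (1 , y) afterFirst)
      ; last           = vertex (end (1 , y) afterFirst)
      ; shape          = shape
      ; distinct       = Linked⇒Unique {_<_ = _<ₗₑₓ_} (rank ∘ pos) <ₗₑₓ-trans <ₗₑₓ-irrefl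
                           (Linked.map (proj₁ ∘ proj₂) detour-steps)
      ; arcs           = detour-arcs
      ; firstInA       = vertex∈sides (proj₁ (good-row z≤n)) (inj₁ refl)
      ; lastInA        = subst (λ p → vertex p ∈ sides) (sym route-end)
                           (vertex∈sides (proj₁ (good-row ≤-refl)) (inj₂ refl))
      ; interiorNotInA = All.map (λ {v} ((u , in-arc) , (w , out-arc)) → interior-vertex∉sides {u} {v} {w} in-arc out-arc)
                           (Linked-interior-neighbours _ (subst (Linked λ u v → T (grid u v)) shape detour-arcs))
      ; meetsB         = lose (∈-map⁺ vertex summit∈walk) (vertex∈top (proj₁ (good-column ≤-refl)) refl)
      }
      where
        -- route reduces to east ∷ afterFirst because c = suc b.
        afterFirst : List Move
        afterFirst = (replicate b east ++ replicate (M ∸ y) north) ++ descent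

        shape : detour ≡
                vertex start ∷ map vertex (beforeEnd (1 , y) afterFirst) ++ vertex (end (1 , y) afterFirst) ∷ []
        shape = cong (vertex start ∷_) (begin
          map vertex (walk (1 , y) afterFirst)
            ≡⟨ cong (map vertex) (walk≡beforeEnd++end (1 , y) afterFirst) ⟩
          map vertex (beforeEnd (1 , y) afterFirst ++ end (1 , y) afterFirst ∷ [])
            ≡⟨ map-++ vertex (beforeEnd (1 , y) afterFirst) _ ⟩
          map vertex (beforeEnd (1 , y) afterFirst) ++ vertex (end (1 , y) afterFirst) ∷ [] ∎)
          where open ≡-Reasoning

        summit∈walk : (c , M) ∈ₗ walk start route
        summit∈walk = subst (_∈ₗ walk start route) summit (end∈walk-++ start ascent descent)

    detour-unhit : ¬ HitsAllABAPaths grid sides top S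
    detour-unhit hits =
      let _ , v∈detour , v∈S = hits detour detour-isABAPath
      in All.lookup detour-avoids v∈detour v∈S
      where
        detour-avoids : All (_∉ S) detour
        detour-avoids = All.map⁺ (All.map proj₂ route-good)

  noSmallHittingSet : ∀ K → 3 + (K + K) ≤ M → (S : Subset N) → ∣ S ∣ ≤ K → ¬ HitsAllABAPaths grid sides top S
  noSmallHittingSet K 3+2K≤M S ∣S∣≤K = Detour.detour-unhit S y≤M b+2<M (proj₂ free-row) columns-free
    where
      free-row = ∣p∣≤k⇒misses-fibre K S (proj₂ ∘ pos) ∣S∣≤K
      -- Fibre i of ⌊(x ∸ 1)/2⌋ contains the columns 2i+1 and 2i+2.
      free-pair = ∣p∣≤k⇒misses-fibre K S (λ v → ⌊ pred (proj₁ (pos v)) /2⌋) ∣S∣≤K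

      y = toℕ (proj₁ free-row)
      i = toℕ (proj₁ free-pair)

      ≤K : ∀ (j : Fin (suc K)) → toℕ j ≤ K
      ≤K j = ≤-pred (toℕ<n j)

      y≤M : y ≤ M
      y≤M = ≤-trans (≤K (proj₁ free-row)) (≤-trans (m≤m+n K K) (≤-trans (m≤n+m (K + K) 3) 3+2K≤M))

      b+2<M : 3 + (i + i) ≤ M
      b+2<M = ≤-trans (+-monoʳ-≤ 3 (+-mono-≤ i≤K i≤K)) 3+2K≤M
        where i≤K = ≤K (proj₁ free-pair)

      columns-free : ∀ {v} → v ∈ S → proj₁ (pos v) ≢ suc (i + i) × proj₁ (pos v) ≢ suc (suc (i + i))
      columns-free v∈S =
        (λ x≡ → proj₂ free-pair v∈S (trans (cong (⌊_/2⌋ ∘ pred) x≡) (sym (n≡⌊n+n/2⌋ i)))) ,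
        (λ x≡ → proj₂ free-pair v∈S (trans (cong (⌊_/2⌋ ∘ pred) x≡) (sym (n≡⌈n+n/2⌉ i))))

mainTheorem10 : ¬ (Σ (ℕ → ℕ) λ f → ErdosPosaABA f)
mainTheorem10 (f , erdosPosa) =
  [ noTwoDisjointABAPaths , (λ (S , ∣S∣≤f2 , hits) → noSmallHittingSet (f 2) ≤-refl S ∣S∣≤f2 hits) ]′
    (erdosPosa 2 (s≤s z≤n) _ grid sides top)
  where open Grid (3 + (f 2 + f 2))
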